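{- Let $\gamma\in\mathrm{Clan}_{p,q}$ and let $\omega$ be a partial matching on $[n]$ whose $e$ arcs are labelled bijectively by $1,2,\dots,e$, each arc being marked or unmarked; for an endpoint $i$ of an arc write $\omega(i)$ for the label of that arc. Then $\omega$ is a labelled shape for $\gamma$ if and only if $e=\min(p,q)$ and for all arcs $\{i<j\}$ of $\omega$: (i) $i$ and $j$ are matched in $\gamma$ if the arc is unmarked, and are fixed points of $\gamma$ of opposite sign if the arc is marked; (ii) if $\{i<j\}$ is marked and $i<i'<j$, then $\omega(i')$ is defined and $\omega(i')<\omega(i)=\omega(j)$; (iii) if $\{i'<j'\}$ is an unmarked arc of $\omega$ with $i'<i<j<j'$, then $\omega(i')=\omega(j')<\omega(i)=\omega(j)$.
   Context: Fix integers $p,q\ge0$, $n=p+q$, $[n]=\{1,\dots,n\}$. A $(p,q)$-clan is an involution $\gamma$ of $[n]$ each of whose fixed points is labelled $+$ or $-$, with (number of $+$) $-$ (number of $-$) $=p-q$; $\mathrm{Clan}_{p,q}$ is the set of these, and $i\neq j$ are matched if $\gamma(i)=j$. Labelled shapes are defined by the following nondeterministic deletion process. Start with $S=[n]$. Call a pair $i<j$ in $S$ valid if either $i,j$ are matched in $\gamma$, or $i,j$ are fixed points of $\gamma$ of opposite sign with no $i'\in S$ satisfying $i<i'<j$. While $S$ is not a set of fixed points of $\gamma$ all of the same sign (the empty set counts as such), choose a valid pair $\{i<j\}\subseteq S$ such that there is no pair $i',j'\in S$ matched in $\gamma$ with $i'<i<j<j'$, and delete $i,j$ from $S$. A labelled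 shape for $\gamma$ is the partial matching on $[n]$ obtained from some run of this process, whose arcs are the deleted pairs, the $k$-th deleted pair being labelled $k$, and an arc being marked exactly when its endpoints are fixed points of $\gamma$ (unmarked when they are matched in $\gamma$). -}

module Defs where

open import Data.Nat as ℕ using (ℕ; _+_)
open import Data.Fin using (Fin; _<_)
open import Data.Fin.Properties using (_≟_)
open import Data.Fin.Subset using (Subset; _∈_; _-_) renaming (⊤ to full)
open import Data.Bool using (Bool; true; false)
open import Data.List using (List; []; _∷_; length; filter; lookup; allFin)
open import Data.Product using (_×_; ∃-syntax)
open import Data.Sum using (_⊎_)
open import Data.Empty using (⊥)
open import Relation.Nullary using (¬_; Dec; yes; no)
open import Relation.Nullary.Decidable using (_×-dec_)
open import Relation.Binary.PropositionalEquality using (_≡_; _≢_; refl)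

data Sign : Set where
  plus minus : Sign

_≟ₛ_ : (a b : Sign) → Dec (a ≡ b)
plus  ≟ₛ plus  = yes refl
plus  ≟ₛ minus = no λ ()
minus ≟ₛ plus  = no λ ()
minus ≟ₛ minus = yes refl

-- (p,q)-clans on [n] = Fin n with n = p + q (positions 1..n are 0..n-1).
-- An involution γ; every position carries a sign, but only signs of fixed
-- points are meaningful (the sign at a non-fixed point is ignored).

nFixed : ∀ {n} → (Fin n → Fin n) → (Fin n → Sign) → Sign → ℕ
nFixed {n} γ s σ = length (filter (λ i → (γ i ≟ i) ×-dec (s i ≟ₛ σ)) (allFin n))

record Clan (p q : ℕ) : Set where
  field
    γ       : Fin (p + q) → Fin (p + q)
    invol   : ∀ i → γ (γ i) ≡ i
    sgn     : Fin (p + q) → Sign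
    -- (#plus fixed points) - (#minus fixed points) = p - q
    balance : nFixed γ sgn plus + q ≡ nFixed γ sgn minus + p

record Arc (n : ℕ) : Set where
  constructor arc
  field
    left   : Fin n
    right  : Fin n
    lt     : left < right
    marked : Bool
open Arc public

_∈ₐ_ : ∀ {n} → Fin n → Arc n → Set
x ∈ₐ a = x ≡ left a ⊎ x ≡ right a

-- A labelled (marked) partial matching with e arcs labelled 1..e is a list
-- of arcs: the arc at (0-based) position k carries the label k+1, so
-- e = length ω and label comparisons are comparisons of positions.
IsPartialMatching : ∀ {n} → List (Arc n) → Set
IsPartialMatching ω =
  ∀ (k l : Fin (length ω)) (x : Fin _) →
    x ∈ₐ lookup ω k → x ∈ₐ lookup ω l → k ≡ l

module _ {p q : ℕ} (C : Clan p q) where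
  open Clan C

  Terminal : Subset (p + q) → Set
  Terminal S =
    (∀ i → i ∈ S → γ i ≡ i) × (∀ i j → i ∈ S → j ∈ S → sgn i ≡ sgn j)

  data ValidArc (S : Subset (p + q)) : Arc (p + q) → Set where
    matchedPair : ∀ {i j} (i<j : i < j) → i ∈ S → j ∈ S → γ i ≡ j →
                  ValidArc S (arc i j i<j false)
    oppositePair : ∀ {i j} (i<j : i < j) → i ∈ S → j ∈ S →
                   γ i ≡ i → γ j ≡ j → sgn i ≢ sgn j →
                   (∀ i' → i' ∈ S → i < i' → ¬ (i' < j)) →
                   ValidArc S (arc i j i<j true)

  NotNested : Subset (p + q) → Arc (p + q) → Set
  NotNested S a = ∀ i' j' → i' ∈ S → j' ∈ S → γ i' ≡ j' →
                  i' < left a → right a < j' → ⊥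

  data Run : Subset (p + q) → List (Arc (p + q)) → Set where
    stop : ∀ {S} → Terminal S → Run S []
    step : ∀ {S a ω} → ¬ Terminal S → ValidArc S a → NotNested S a →
           Run ((S - left a) - right a) ω → Run S (a ∷ ω)

  -- ω is a labelled shape for γ (the k-th deleted pair has label k)
  IsLabelledShape : List (Arc (p + q)) → Set
  IsLabelledShape ω = Run full ω

  CondI : Arc (p + q) → Set
  CondI a =
    (marked a ≡ false → γ (left a) ≡ right a) ×
    (marked a ≡ true → γ (left a) ≡ left a × γ (right a) ≡ right a ×
                       sgn (left a) ≢ sgn (right a))

  CondII : (ω : List (Arc (p + q))) → Fin (length ω) → Set
  CondII ω k = marked (lookup ω k) ≡ true →
    ∀ i' → left (lookup ω k) < i' → i' < right (lookup ω k) →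
      ∃[ k' ] (i' ∈ₐ lookup ω k' × k' < k)

  CondIII : (ω : List (Arc (p + q))) → Fin (length ω) → Set
  CondIII ω k = ∀ (k' : Fin (length ω)) → marked (lookup ω k') ≡ false →
    left (lookup ω k') < left (lookup ω k) →
    right (lookup ω k) < right (lookup ω k') → k' < k

-- For S ⊆ [n] let N(S), P(S), M(S) count the points of S that are moved by γ,
-- fixed with sign +, and fixed with sign -, and call
--     defect(S) = N(S) + 2 · min(P(S), M(S)).
-- Deleting a valid pair lowers the defect by exactly 2 (a matched pair removes
-- two moved points, an opposite pair one fixed point of each sign), the defect
-- vanishes exactly on terminal sets, and the balance condition of the clan
-- gives defect([n]) = 2 · min(p,q).  Hence a sequence of valid deletions from
-- [n] ends in a terminal set iff it has length min(p,q).
--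
-- In that description validity and non-nestedness at stage S_k
-- translate into the conditions (i)-(iii), which proves both directions.
module Submission where

open import Defs
open import Data.Nat using (ℕ; _+_; _⊓_)
open import Data.Fin using (Fin)
open import Data.List using (List; length; lookup)
open import Data.Product using (_×_)
open import Function.Bundles using (_⇔_)
open import Relation.Binary.PropositionalEquality using (_≡_)

open import Data.Nat using (zero; suc; _*_; z≤n; s≤s) renaming (_<_ to _<ℕ_)
open import Data.Nat.Properties
  using (+-assoc; *-suc; +-identityʳ; +-cancelˡ-≡; +-cancelʳ-≡; *-cancelˡ-≡; m+n≡0⇒m≡0;
         m+n≡0⇒n≡0; ⊓-zeroʳ; +-distribˡ-⊓; +-distribʳ-⊓; ≤-refl; <-irrefl;
         +-commutativeSemigroup)
open import Algebra.Properties.CommutativeSemigroup +-commutativeSemigroup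
  using (x∙yz≈y∙xz; interchange)
open import Data.Nat.Tactic.RingSolver using (solve-∀)
open import Data.Fin using (zero; suc; toℕ; _<_)
import Data.Fin.Properties as Fin
open import Data.Fin.Subset using (Subset; _∈_; _∉_; _-_; ⁅_⁆; inside; outside)
  renaming (⊤ to full)
open import Data.Fin.Subset.Properties using (∈⊤; p─⊥≡p; p─q⊆p; x∈p∧x≢y⇒x∈p-y; nonempty?)
open import Data.Vec using ([]; _∷_; here; there)
open import Data.List using (_∷_; []; filter; tabulate; take)
open import Data.List.Properties using (take-all)
open import Data.Bool using (true; false)
open import Data.Product using (_,_; proj₁; proj₂; ∃-syntax)
open import Data.Sum using (_⊎_; inj₁; inj₂; [_,_])
open import Data.Empty using (⊥)
open import Function using (_∘_)
open import Function.Bundles using (Equivalence; mk⇔)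
open import Relation.Nullary using (¬_; Dec; yes; no; contradiction)
open import Relation.Nullary.Decidable using (_×-dec_; ¬?; decidable-stable)
open import Relation.Binary.PropositionalEquality
  using (_≢_; refl; sym; trans; cong; cong₂; subst; subst₂; module ≡-Reasoning)
open ≡-Reasoning

𝟙 : ∀ {P : Set} → Dec P → ℕ
𝟙 (yes _) = 1
𝟙 (no _)  = 0

𝟙-yes : ∀ {P : Set} (d : Dec P) → P → 𝟙 d ≡ 1
𝟙-yes (yes _)  _ = refl
𝟙-yes (no ¬p)  p = contradiction p ¬p

𝟙-no : ∀ {P : Set} (d : Dec P) → ¬ P → 𝟙 d ≡ 0
𝟙-no (yes p) ¬p = contradiction p ¬p
𝟙-no (no _)  _  = refl

𝟙-zero : ∀ {P : Set} (d : Dec P) → 𝟙 d ≡ 0 → ¬ P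
𝟙-zero (yes _)  ()
𝟙-zero (no ¬p)  _ = ¬p

𝟙-cong : ∀ {P Q : Set} → (P → Q) → (Q → P) → (d : Dec P) (e : Dec Q) → 𝟙 d ≡ 𝟙 e
𝟙-cong _   _   (yes _)  (yes _)  = refl
𝟙-cong P⇒Q _   (yes p)  (no ¬q)  = contradiction (P⇒Q p) ¬q
𝟙-cong _   Q⇒P (no ¬p)  (yes q)  = contradiction (Q⇒P q) ¬p
𝟙-cong _   _   (no _)   (no _)   = refl

sumOver : ∀ {n} → Subset n → (Fin n → ℕ) → ℕ
sumOver []            w = 0
sumOver (inside  ∷ S) w = w zero + sumOver S (w ∘ suc)
sumOver (outside ∷ S) w = sumOver S (w ∘ suc)

sumOver-remove : ∀ {n} (S : Subset n) (w : Fin n → ℕ) {x : Fin n} → x ∈ S →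
                 sumOver S w ≡ w x + sumOver (S - x) w
sumOver-remove (inside ∷ S) w {zero} here =
  cong (λ T → w zero + sumOver T (w ∘ suc)) (sym (p─⊥≡p S))
sumOver-remove (inside ∷ S) w {suc x} (there x∈S) = begin
  w zero + sumOver S (w ∘ suc)
    ≡⟨ cong (w zero +_) (sumOver-remove S (w ∘ suc) x∈S) ⟩
  w zero + (w (suc x) + sumOver (S - x) (w ∘ suc))
    ≡⟨ x∙yz≈y∙xz (w zero) (w (suc x)) _ ⟩
  w (suc x) + (w zero + sumOver (S - x) (w ∘ suc))  ∎
sumOver-remove (outside ∷ S) w {suc x} (there x∈S) = sumOver-remove S (w ∘ suc) x∈S

sumOver-remove₂ : ∀ {n} (S : Subset n) (w : Fin n → ℕ) {x y : Fin n} →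
                  x ∈ S → y ∈ S → x ≢ y →
                  sumOver S w ≡ (w x + w y) + sumOver (S - x - y) w
sumOver-remove₂ S w {x} {y} x∈S y∈S x≢y = begin
  sumOver S w
    ≡⟨ sumOver-remove S w x∈S ⟩
  w x + sumOver (S - x) w
    ≡⟨ cong (w x +_) (sumOver-remove (S - x) w (x∈p∧x≢y⇒x∈p-y y∈S (x≢y ∘ sym))) ⟩
  w x + (w y + sumOver (S - x - y) w)
    ≡⟨ sym (+-assoc (w x) (w y) _) ⟩
  (w x + w y) + sumOver (S - x - y) w  ∎

sumOver-zero⁻ : ∀ {n} (S : Subset n) (w : Fin n → ℕ) → sumOver S w ≡ 0 →
                ∀ {x} → x ∈ S → w x ≡ 0
sumOver-zero⁻ S w sum≡0 x∈S = m+n≡0⇒m≡0 _ (trans (sym (sumOver-remove S w x∈S)) sum≡0)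

sumOver-zero⁺ : ∀ {n} (S : Subset n) (w : Fin n → ℕ) → (∀ x → x ∈ S → w x ≡ 0) →
                sumOver S w ≡ 0
sumOver-zero⁺ []            w _      = refl
sumOver-zero⁺ (inside  ∷ S) w vanish =
  cong₂ _+_ (vanish zero here) (sumOver-zero⁺ S (w ∘ suc) (λ x x∈S → vanish (suc x) (there x∈S)))
sumOver-zero⁺ (outside ∷ S) w vanish =
  sumOver-zero⁺ S (w ∘ suc) (λ x x∈S → vanish (suc x) (there x∈S))

sumOver-+ : ∀ {n} (S : Subset n) (w v : Fin n → ℕ) →
            sumOver S (λ i → w i + v i) ≡ sumOver S w + sumOver S v
sumOver-+ []            w v = refl
sumOver-+ (inside  ∷ S) w v = begin
  (w zero + v zero) + sumOver S (λ i → w (suc i) + v (suc i))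
    ≡⟨ cong ((w zero + v zero) +_) (sumOver-+ S (w ∘ suc) (v ∘ suc)) ⟩
  (w zero + v zero) + (sumOver S (w ∘ suc) + sumOver S (v ∘ suc))
    ≡⟨ interchange (w zero) (v zero) _ _ ⟩
  (w zero + sumOver S (w ∘ suc)) + (v zero + sumOver S (v ∘ suc))  ∎
sumOver-+ (outside ∷ S) w v = sumOver-+ S (w ∘ suc) (v ∘ suc)

sumOver-cong : ∀ {n} (S : Subset n) {w v : Fin n → ℕ} → (∀ i → w i ≡ v i) →
               sumOver S w ≡ sumOver S v
sumOver-cong []            _  = refl
sumOver-cong (inside  ∷ S) eq = cong₂ _+_ (eq zero) (sumOver-cong S (eq ∘ suc))
sumOver-cong (outside ∷ S) eq = sumOver-cong S (eq ∘ suc)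

sumOver-full-1 : ∀ n → sumOver (full {n}) (λ _ → 1) ≡ n
sumOver-full-1 zero    = refl
sumOver-full-1 (suc n) = cong suc (sumOver-full-1 n)

filter-length : ∀ {n} {A : Set} {P : A → Set} (P? : ∀ x → Dec (P x)) (f : Fin n → A) →
                length (filter P? (tabulate f)) ≡ sumOver full (λ i → 𝟙 (P? (f i)))
filter-length {zero}  P? f = refl
filter-length {suc n} P? f with P? (f zero)
... | yes _ = cong suc (filter-length P? (f ∘ suc))
... | no  _ = filter-length P? (f ∘ suc)

remaining : ∀ {n} → Subset n → List (Arc n) → Subset n
remaining S []      = S
remaining S (a ∷ ω) = remaining (S - left a - right a) ω

∉-removed : ∀ {n} (S : Subset n) (x : Fin n) → x ∉ S - x
∉-removed (_ ∷ S) zero    ()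
∉-removed (_ ∷ S) (suc x) (there x∈S-x) = ∉-removed S x x∈S-x

∈-removed : ∀ {n} {S : Subset n} {x y : Fin n} → x ∈ S - y → x ∈ S × x ≢ y
∈-removed {S = S} {y = y} x∈S-y =
  p─q⊆p S ⁅ y ⁆ x∈S-y , λ { refl → ∉-removed S y x∈S-y }

∈-remaining : ∀ {n} (S : Subset n) (ω : List (Arc n)) (m : ℕ) {x : Fin n} →
              x ∈ remaining S (take m ω) →
              x ∈ S × (∀ k → toℕ k <ℕ m → ¬ x ∈ₐ lookup ω k)
∈-remaining S ω       zero    x∈ = x∈ , λ _ ()
∈-remaining S []      (suc m) x∈ = x∈ , λ ()
∈-remaining S (a ∷ ω) (suc m) {x} x∈ = proj₁ notLeft , off
  where
  survivor : x ∈ S - left a - right a × (∀ k → toℕ k <ℕ m → ¬ x ∈ₐ lookup ω k)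
  survivor = ∈-remaining (S - left a - right a) ω m x∈
  notRight : x ∈ S - left a × x ≢ right a
  notRight = ∈-removed (proj₁ survivor)
  notLeft : x ∈ S × x ≢ left a
  notLeft = ∈-removed (proj₁ notRight)
  off : ∀ k → toℕ k <ℕ suc m → ¬ x ∈ₐ lookup (a ∷ ω) k
  off zero    _         (inj₁ x≡l) = proj₂ notLeft x≡l
  off zero    _         (inj₂ x≡r) = proj₂ notRight x≡r
  off (suc k) (s≤s k<m) x∈k        = proj₂ survivor k k<m x∈k

remaining-or-deleted : ∀ {n} (S : Subset n) (ω : List (Arc n)) (m : ℕ) {x : Fin n} →
                       x ∈ S →
                       x ∈ remaining S (take m ω) ⊎ ∃[ k ] (x ∈ₐ lookup ω k × toℕ k <ℕ m)
remaining-or-deleted S ω       zero    x∈S = inj₁ x∈S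
remaining-or-deleted S []      (suc m) x∈S = inj₁ x∈S
remaining-or-deleted S (a ∷ ω) (suc m) {x} x∈S with x Fin.≟ left a | x Fin.≟ right a
... | yes x≡l | _        = inj₂ (zero , inj₁ x≡l , s≤s z≤n)
... | no _    | yes x≡r  = inj₂ (zero , inj₂ x≡r , s≤s z≤n)
... | no x≢l  | no x≢r
  with remaining-or-deleted (S - left a - right a) ω m
         (x∈p∧x≢y⇒x∈p-y (x∈p∧x≢y⇒x∈p-y x∈S x≢l) x≢r)
...   | inj₁ survives             = inj₁ survives
...   | inj₂ (k , x∈k , k<m)      = inj₂ (suc k , x∈k , s≤s k<m)

-- In a partial matching an endpoint of arc k lies on no other arc, so it
-- survives the deletion of every prefix that does not contain arc k.
endpoint-remains : ∀ {n} {ω : List (Arc n)} → IsPartialMatching ω →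
                   ∀ (S : Subset n) (m : ℕ) {k x} → x ∈ S → x ∈ₐ lookup ω k →
                   ¬ (toℕ k <ℕ m) → x ∈ remaining S (take m ω)
endpoint-remains PM S m x∈S x∈k k≮m with remaining-or-deleted S _ m x∈S
... | inj₁ survives            = survives
... | inj₂ (k' , x∈k' , k'<m)  =
  contradiction (subst (λ j → toℕ j <ℕ m) (PM k' _ _ x∈k' x∈k) k'<m) k≮m

defectOf : ℕ → ℕ → ℕ → ℕ
defectOf N P M = N + 2 * (P ⊓ M)

defectOf-opposite : ∀ N P M → defectOf N (suc P) (suc M) ≡ 2 + defectOf N P M
defectOf-opposite N P M = shift N (P ⊓ M)
  where
  shift : ∀ a b → a + 2 * suc b ≡ 2 + (a + 2 * b)
  shift = solve-∀

⊓≡0 : ∀ a b → a ⊓ b ≡ 0 → a ≡ 0 ⊎ b ≡ 0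
⊓≡0 zero    _       _  = inj₁ refl
⊓≡0 (suc _) zero    _  = inj₂ refl
⊓≡0 (suc _) (suc _) ()

defectOf≡0 : ∀ N P M → defectOf N P M ≡ 0 → N ≡ 0 × (P ≡ 0 ⊎ M ≡ 0)
defectOf≡0 N P M eq = m+n≡0⇒m≡0 N eq , ⊓≡0 P M (m+n≡0⇒m≡0 (P ⊓ M) (m+n≡0⇒n≡0 N eq))

defectOf-zero : ∀ {N P M} → N ≡ 0 → P ≡ 0 ⊎ M ≡ 0 → defectOf N P M ≡ 0
defectOf-zero             refl (inj₁ refl) = refl
defectOf-zero {P = P} refl (inj₂ refl) = cong (2 *_) (⊓-zeroʳ P)

-- If N + P + M = p + q and P - M = p - q, then N + 2 min(P,M) = 2 min(p,q):
-- the identity min(P,M) + (p + q) = (P + q) + min(p,q) reduces it to linear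
-- arithmetic.
defectOf-balanced : ∀ N P M p q → N + P + M ≡ p + q → P + q ≡ M + p →
                    defectOf N P M ≡ 2 * (p ⊓ q)
defectOf-balanced N P M p q total balance =
  +-cancelʳ-≡ (2 * (p + q)) (defectOf N P M) (2 * (p ⊓ q)) (linear (P ⊓ M) (p ⊓ q) shift)
  where
  shift : P ⊓ M + (p + q) ≡ (P + q) + p ⊓ q
  shift = begin
    P ⊓ M + (p + q)              ≡⟨ +-distribʳ-⊓ (p + q) P M ⟩
    (P + (p + q)) ⊓ (M + (p + q)) ≡⟨ cong₂ _⊓_ (regroupP P p q) (sym (+-assoc M p q)) ⟩
    (P + q + p) ⊓ (M + p + q)    ≡⟨ cong (λ t → (P + q + p) ⊓ (t + q)) (sym balance) ⟩
    (P + q + p) ⊓ (P + q + q)    ≡⟨ sym (+-distribˡ-⊓ (P + q) p q) ⟩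
    (P + q) + p ⊓ q              ∎
    where
    regroupP : ∀ a b c → a + (b + c) ≡ a + c + b
    regroupP = solve-∀
  linear : ∀ X Y → X + (p + q) ≡ (P + q) + Y → N + 2 * X + 2 * (p + q) ≡ 2 * Y + 2 * (p + q)
  linear X Y eq = begin
    N + 2 * X + 2 * (p + q)            ≡⟨ factor N X (p + q) ⟩
    N + 2 * (X + (p + q))              ≡⟨ cong (λ t → N + 2 * t) eq ⟩
    N + 2 * ((P + q) + Y)              ≡⟨ expand N (P + q) Y ⟩
    N + (P + q) + (P + q) + 2 * Y      ≡⟨ cong (λ t → N + (P + q) + t + 2 * Y) balance ⟩
    N + (P + q) + (M + p) + 2 * Y      ≡⟨ regroup N P M p q Y ⟩
    (N + P + M) + (p + q) + 2 * Y      ≡⟨ cong (λ t → t + (p + q) + 2 * Y) total ⟩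
    (p + q) + (p + q) + 2 * Y          ≡⟨ collect (p + q) Y ⟩
    2 * Y + 2 * (p + q)                ∎
    where
    factor : ∀ a b c → a + 2 * b + 2 * c ≡ a + 2 * (b + c)
    factor = solve-∀
    expand : ∀ a b c → a + 2 * (b + c) ≡ a + b + b + 2 * c
    expand = solve-∀
    regroup : ∀ a b c d e f → a + (b + e) + (c + d) + 2 * f ≡ (a + b + c) + (d + e) + 2 * f
    regroup = solve-∀
    collect : ∀ a b → a + a + 2 * b ≡ 2 * b + 2 * a
    collect = solve-∀

opposite : Sign → Sign
opposite plus  = minus
opposite minus = plus

≢opposite : ∀ σ → σ ≢ opposite σ
≢opposite plus  ()
≢opposite minus ()

≢⇒opposite : ∀ {s σ} → s ≢ σ → s ≡ opposite σ
≢⇒opposite {plus}  {plus}  s≢σ = contradiction refl s≢σ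
≢⇒opposite {plus}  {minus} _   = refl
≢⇒opposite {minus} {plus}  _   = refl
≢⇒opposite {minus} {minus} s≢σ = contradiction refl s≢σ

one-sign : ∀ s → 𝟙 (s ≟ₛ plus) + 𝟙 (s ≟ₛ minus) ≡ 1
one-sign plus  = refl
one-sign minus = refl

different-signs : ∀ {s t} → s ≢ t → ∀ σ → 𝟙 (s ≟ₛ σ) + 𝟙 (t ≟ₛ σ) ≡ 1
different-signs {plus}  {plus}  s≢t _     = contradiction refl s≢t
different-signs {minus} {minus} s≢t _     = contradiction refl s≢t
different-signs {plus}  {minus} _   plus  = refl
different-signs {plus}  {minus} _   minus = refl
different-signs {minus} {plus}  _   plus  = refl
different-signs {minus} {plus}  _   minus = refl

module _ {p q : ℕ} (C : Clan p q) where
  open Clan C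

  swap : ∀ {i j} → γ i ≡ j → γ j ≡ i
  swap {i} γi≡j = trans (cong γ (sym γi≡j)) (invol i)

  moved : Fin (p + q) → ℕ
  moved i = 𝟙 (¬? (γ i Fin.≟ i))

  fixedWith : Sign → Fin (p + q) → ℕ
  fixedWith σ i = 𝟙 ((γ i Fin.≟ i) ×-dec (sgn i ≟ₛ σ))

  weights-moved : ∀ {i} → γ i ≢ i → moved i ≡ 1 × (∀ σ → fixedWith σ i ≡ 0)
  weights-moved γi≢i = 𝟙-yes _ γi≢i , λ σ → 𝟙-no _ (γi≢i ∘ proj₁)

  weights-fixed : ∀ {i} → γ i ≡ i → moved i ≡ 0 × (∀ σ → fixedWith σ i ≡ 𝟙 (sgn i ≟ₛ σ))
  weights-fixed γi≡i = 𝟙-no _ (λ γi≢i → γi≢i γi≡i) , λ σ → 𝟙-cong proj₂ (γi≡i ,_) _ _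

  one-kind : ∀ i → moved i + fixedWith plus i + fixedWith minus i ≡ 1
  one-kind i = by-cases (γ i Fin.≟ i)
    where
    by-cases : Dec (γ i ≡ i) → moved i + fixedWith plus i + fixedWith minus i ≡ 1
    by-cases (no γi≢i)  = let (m , f) = weights-moved γi≢i in
      cong₂ _+_ (cong₂ _+_ m (f plus)) (f minus)
    by-cases (yes γi≡i) = let (m , f) = weights-fixed γi≡i in
      trans (cong₂ _+_ (cong₂ _+_ m (f plus)) (f minus)) (one-sign (sgn i))

  PairWeights : Fin (p + q) → Fin (p + q) → ℕ → ℕ → Set
  PairWeights i j m f = moved i + moved j ≡ m × (∀ σ → fixedWith σ i + fixedWith σ j ≡ f)

  matched-weights : ∀ {i j} → i ≢ j → γ i ≡ j → PairWeights i j 2 0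
  matched-weights {i} {j} i≢j γi≡j =
    cong₂ _+_ (proj₁ wi) (proj₁ wj) , λ σ → cong₂ _+_ (proj₂ wi σ) (proj₂ wj σ)
    where
    wi : moved i ≡ 1 × (∀ σ → fixedWith σ i ≡ 0)
    wi = weights-moved (λ γi≡i → i≢j (trans (sym γi≡i) γi≡j))
    wj : moved j ≡ 1 × (∀ σ → fixedWith σ j ≡ 0)
    wj = weights-moved (λ γj≡j → i≢j (trans (sym (swap γi≡j)) γj≡j))

  opposite-weights : ∀ {i j} → γ i ≡ i → γ j ≡ j → sgn i ≢ sgn j → PairWeights i j 0 1
  opposite-weights {i} {j} γi≡i γj≡j s≢ =
    cong₂ _+_ (proj₁ wi) (proj₁ wj) ,
    λ σ → trans (cong₂ _+_ (proj₂ wi σ) (proj₂ wj σ)) (different-signs s≢ σ)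
    where
    wi : moved i ≡ 0 × (∀ σ → fixedWith σ i ≡ 𝟙 (sgn i ≟ₛ σ))
    wi = weights-fixed γi≡i
    wj : moved j ≡ 0 × (∀ σ → fixedWith σ j ≡ 𝟙 (sgn j ≟ₛ σ))
    wj = weights-fixed γj≡j

  countMoved : Subset (p + q) → ℕ
  countMoved S = sumOver S moved

  countFixed : Sign → Subset (p + q) → ℕ
  countFixed σ S = sumOver S (fixedWith σ)

  defect : Subset (p + q) → ℕ
  defect S = defectOf (countMoved S) (countFixed plus S) (countFixed minus S)

  defect-remove₂ : ∀ {S i j m f} → i ∈ S → j ∈ S → i ≢ j → PairWeights i j m f →
    defect S ≡ defectOf (m + countMoved (S - i - j)) (f + countFixed plus (S - i - j))
                        (f + countFixed minus (S - i - j))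
  defect-remove₂ {S} {i} {j} {m} {f} i∈S j∈S i≢j (wm , wf) = begin
    defectOf (countMoved S) (countFixed plus S) (countFixed minus S)
      ≡⟨ cong (λ N → defectOf N (countFixed plus S) (countFixed minus S)) (removing moved wm) ⟩
    defectOf (m + countMoved (S - i - j)) (countFixed plus S) (countFixed minus S)
      ≡⟨ cong₂ (defectOf (m + countMoved (S - i - j)))
               (removing (fixedWith plus) (wf plus)) (removing (fixedWith minus) (wf minus)) ⟩
    defectOf (m + countMoved (S - i - j)) (f + countFixed plus (S - i - j))
             (f + countFixed minus (S - i - j))  ∎
    where
    removing : ∀ w {c} → w i + w j ≡ c → sumOver S w ≡ c + sumOver (S - i - j) w
    removing w eq = trans (sumOver-remove₂ S w i∈S j∈S i≢j) (cong (_+ sumOver (S - i - j) w) eq)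

  defect-step : ∀ {S a} → ValidArc C S a → defect S ≡ 2 + defect (S - left a - right a)
  defect-step (matchedPair i<j i∈S j∈S γi≡j) =
    defect-remove₂ i∈S j∈S (Fin.<⇒≢ i<j) (matched-weights (Fin.<⇒≢ i<j) γi≡j)
  defect-step (oppositePair i<j i∈S j∈S γi≡i γj≡j s≢ _) =
    trans (defect-remove₂ i∈S j∈S (Fin.<⇒≢ i<j) (opposite-weights γi≡i γj≡j s≢))
          (defectOf-opposite _ _ _)

  common-sign : ∀ {S} → Terminal C S → ∃[ σ ] (∀ j → j ∈ S → sgn j ≡ σ)
  common-sign {S} (_ , sameSign) with nonempty? S
  ... | yes (i , i∈S) = sgn i , λ j j∈S → sameSign j i j∈S i∈S
  ... | no empty      = plus , λ j j∈S → contradiction (j , j∈S) empty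

  no-opposite : ∀ {S} σ → (∀ j → j ∈ S → sgn j ≡ σ) → countFixed (opposite σ) S ≡ 0
  no-opposite {S} σ signσ = sumOver-zero⁺ S (fixedWith (opposite σ))
    λ j j∈S → 𝟙-no _ λ (_ , sj≡) → ≢opposite σ (trans (sym (signσ j j∈S)) sj≡)

  terminal⇒defect≡0 : ∀ {S} → Terminal C S → defect S ≡ 0
  terminal⇒defect≡0 {S} T@(fixed , _) =
    defectOf-zero {countMoved S} {countFixed plus S} {countFixed minus S}
                  noneMoved (missingSign (common-sign T))
    where
    noneMoved : countMoved S ≡ 0
    noneMoved = sumOver-zero⁺ S moved λ i i∈S → proj₁ (weights-fixed (fixed i i∈S))
    missingSign : ∃[ σ ] (∀ j → j ∈ S → sgn j ≡ σ) →
                  countFixed plus S ≡ 0 ⊎ countFixed minus S ≡ 0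
    missingSign (plus  , signσ) = inj₂ (no-opposite plus signσ)
    missingSign (minus , signσ) = inj₁ (no-opposite minus signσ)

  defect≡0⇒terminal : ∀ {S} → defect S ≡ 0 → Terminal C S
  defect≡0⇒terminal {S} eq = fixed , [ sameSign plus , sameSign minus ] (proj₂ vanishing)
    where
    vanishing : countMoved S ≡ 0 × (countFixed plus S ≡ 0 ⊎ countFixed minus S ≡ 0)
    vanishing = defectOf≡0 _ _ _ eq
    fixed : ∀ i → i ∈ S → γ i ≡ i
    fixed i i∈S =
      decidable-stable (γ i Fin.≟ i) (𝟙-zero _ (sumOver-zero⁻ S moved (proj₁ vanishing) i∈S))
    sameSign : ∀ σ → countFixed σ S ≡ 0 → ∀ i j → i ∈ S → j ∈ S → sgn i ≡ sgn j
    sameSign σ none i j i∈S j∈S = trans (signOf i∈S) (sym (signOf j∈S))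
      where
      signOf : ∀ {x} → x ∈ S → sgn x ≡ opposite σ
      signOf {x} x∈S = ≢⇒opposite λ sx≡σ →
        𝟙-zero _ (sumOver-zero⁻ S (fixedWith σ) none x∈S) (fixed x x∈S , sx≡σ)

  counts-full : countMoved full + countFixed plus full + countFixed minus full ≡ p + q
  counts-full = begin
    countMoved full + countFixed plus full + countFixed minus full
      ≡⟨ cong (_+ countFixed minus full) (sym (sumOver-+ full moved (fixedWith plus))) ⟩
    sumOver full (λ i → moved i + fixedWith plus i) + countFixed minus full
      ≡⟨ sym (sumOver-+ full _ (fixedWith minus)) ⟩
    sumOver full (λ i → moved i + fixedWith plus i + fixedWith minus i)
      ≡⟨ sumOver-cong full one-kind ⟩
    sumOver (full {p + q}) (λ _ → 1)
      ≡⟨ sumOver-full-1 (p + q) ⟩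
    p + q  ∎

  countFixed-full : ∀ σ → countFixed σ full ≡ nFixed γ sgn σ
  countFixed-full σ = sym (filter-length (λ i → (γ i Fin.≟ i) ×-dec (sgn i ≟ₛ σ)) (λ i → i))

  defect-full : defect full ≡ 2 * (p ⊓ q)
  defect-full = defectOf-balanced _ _ _ p q counts-full (begin
    countFixed plus full + q   ≡⟨ cong (_+ q) (countFixed-full plus) ⟩
    nFixed γ sgn plus + q      ≡⟨ balance ⟩
    nFixed γ sgn minus + p     ≡⟨ cong (_+ p) (countFixed-full minus) ⟨
    countFixed minus full + p  ∎)

  stage : Subset (p + q) → (ω : List (Arc (p + q))) → Fin (length ω) → Subset (p + q)
  stage S ω k = remaining S (take (toℕ k) ω)

  AllValid : Subset (p + q) → List (Arc (p + q)) → Set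
  AllValid S ω = ∀ k → ValidArc C (stage S ω k) (lookup ω k)

  AllNotNested : Subset (p + q) → List (Arc (p + q)) → Set
  AllNotNested S ω = ∀ k → NotNested C (stage S ω k) (lookup ω k)

  valid⇒¬terminal : ∀ {S a} → ValidArc C S a → ¬ Terminal C S
  valid⇒¬terminal (matchedPair i<j i∈S _ γi≡j) (fixed , _) =
    Fin.<⇒≢ i<j (trans (sym (fixed _ i∈S)) γi≡j)
  valid⇒¬terminal (oppositePair _ i∈S j∈S _ _ s≢ _) (_ , sameSign) = s≢ (sameSign _ _ i∈S j∈S)

  run⇒stages : ∀ {S ω} → Run C S ω →
               AllValid S ω × AllNotNested S ω × Terminal C (remaining S ω)
  run⇒stages (stop T) = (λ ()) , (λ ()) , T
  run⇒stages (step _ valid notNested run) =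
    let (valids , notNesteds , T) = run⇒stages run in
    (λ { zero → valid ; (suc k) → valids k }) ,
    (λ { zero → notNested ; (suc k) → notNesteds k }) , T

  stages⇒run : ∀ S ω → AllValid S ω → AllNotNested S ω → Terminal C (remaining S ω) →
               Run C S ω
  stages⇒run S []      _      _          T = stop T
  stages⇒run S (a ∷ ω) valids notNesteds T =
    step (valid⇒¬terminal (valids zero)) (valids zero) (notNesteds zero)
         (stages⇒run (S - left a - right a) ω (valids ∘ suc) (notNesteds ∘ suc) T)

  defect-deletions : ∀ S ω → AllValid S ω → defect S ≡ 2 * length ω + defect (remaining S ω)
  defect-deletions S []      _      = refl
  defect-deletions S (a ∷ ω) valids = begin
    defect S                                      ≡⟨ defect-step (valids zero) ⟩
    2 + defect S'                                 ≡⟨ cong (2 +_) (defect-deletions S' ω (valids ∘ suc)) ⟩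
    2 + (2 * length ω + defect (remaining S' ω))  ≡⟨ cong (_+ defect (remaining S' ω)) (*-suc 2 (length ω)) ⟨
    2 * suc (length ω) + defect (remaining S' ω)  ∎
    where
    S' : Subset (p + q)
    S' = S - left a - right a

  terminal⇔length : ∀ ω → AllValid full ω → Terminal C (remaining full ω) ⇔ length ω ≡ p ⊓ q
  terminal⇔length ω valids = mk⇔ terminal⇒length length⇒terminal
    where
    total : 2 * length ω + defect (remaining full ω) ≡ 2 * (p ⊓ q)
    total = trans (sym (defect-deletions full ω valids)) defect-full
    terminal⇒length : Terminal C (remaining full ω) → length ω ≡ p ⊓ q
    terminal⇒length T = *-cancelˡ-≡ (length ω) (p ⊓ q) 2 (begin
      2 * length ω                              ≡⟨ +-identityʳ _ ⟨
      2 * length ω + 0                          ≡⟨ cong (2 * length ω +_) (terminal⇒defect≡0 T) ⟨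
      2 * length ω + defect (remaining full ω)  ≡⟨ total ⟩
      2 * (p ⊓ q)                               ∎)
    length⇒terminal : length ω ≡ p ⊓ q → Terminal C (remaining full ω)
    length⇒terminal len = defect≡0⇒terminal (+-cancelˡ-≡ (2 * length ω) _ 0 (begin
      2 * length ω + defect (remaining full ω)  ≡⟨ total ⟩
      2 * (p ⊓ q)                               ≡⟨ cong (2 *_) len ⟨
      2 * length ω                              ≡⟨ +-identityʳ _ ⟨
      2 * length ω + 0                          ∎))

  Conditions : (ω : List (Arc (p + q))) → Fin (length ω) → Set
  Conditions ω k = CondI C (lookup ω k) × CondII C ω k × CondIII C ω k

  valid⇒condI : ∀ {S a} → ValidArc C S a → CondI C a
  valid⇒condI (matchedPair _ _ _ γi≡j)            = (λ _ → γi≡j) , λ ()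
  valid⇒condI (oppositePair _ _ _ γi≡i γj≡j s≢ _) = (λ ()) , λ _ → γi≡i , γj≡j , s≢

  condI⇒valid : ∀ {S} a → CondI C a → left a ∈ S → right a ∈ S →
                (marked a ≡ true → ∀ i' → left a < i' → i' < right a → i' ∉ S) →
                ValidArc C S a
  condI⇒valid (arc l r l<r false) (matched , _) l∈S r∈S _ =
    matchedPair l<r l∈S r∈S (matched refl)
  condI⇒valid (arc l r l<r true) (_ , fixedPair) l∈S r∈S gap =
    let (γl≡l , γr≡r , s≢) = fixedPair refl in
    oppositePair l<r l∈S r∈S γl≡l γr≡r s≢ (λ i' i'∈S l<i' i'<r → gap refl i' l<i' i'<r i'∈S)

  valid-gap : ∀ {S a} → ValidArc C S a → marked a ≡ true →
              ∀ i' → left a < i' → i' < right a → i' ∉ S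
  valid-gap (matchedPair _ _ _ _) ()
  valid-gap (oppositePair _ _ _ _ _ _ between) _ i' l<i' i'<r i'∈S = between i' i'∈S l<i' i'<r

  moved-endpoint⇒unmarked : ∀ a {x} → CondI C a → x ∈ₐ a → γ x ≢ x → marked a ≡ false
  moved-endpoint⇒unmarked (arc _ _ _ false) _               _           _    = refl
  moved-endpoint⇒unmarked (arc _ _ _ true)  (_ , fixedPair) (inj₁ refl) γx≢x =
    contradiction (proj₁ (fixedPair refl)) γx≢x
  moved-endpoint⇒unmarked (arc _ _ _ true)  (_ , fixedPair) (inj₂ refl) γx≢x =
    contradiction (proj₁ (proj₂ (fixedPair refl))) γx≢x

  -- (ii): a point strictly inside a marked valid pair is missing from its
  -- stage, so an earlier arc has deleted it.
  valid⇒condII : ∀ ω k → ValidArc C (stage full ω k) (lookup ω k) → CondII C ω k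
  valid⇒condII ω k valid isMarked i' l<i' i'<r
    with remaining-or-deleted full ω (toℕ k) (∈⊤ {x = i'})
  ... | inj₁ i'∈stage = contradiction i'∈stage (valid-gap valid isMarked i' l<i' i'<r)
  ... | inj₂ deleted  = deleted

  -- (iii): an unmarked arc k' enclosing arc k that were not deleted before
  -- arc k would be a matched pair of stage k enclosing arc k.
  notNested⇒condIII : ∀ ω → IsPartialMatching ω → AllValid full ω →
                      ∀ k → NotNested C (stage full ω k) (lookup ω k) → CondIII C ω k
  notNested⇒condIII ω PM valids k notNested k' unmarked l'<l r<r' =
    decidable-stable (k' Fin.<? k) λ k'≮k →
      notNested (left (lookup ω k')) (right (lookup ω k'))
                (endpoint-remains PM full (toℕ k) ∈⊤ (inj₁ refl) k'≮k)
                (endpoint-remains PM full (toℕ k) ∈⊤ (inj₂ refl) k'≮k)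
                (proj₁ (valid⇒condI (valids k')) unmarked) l'<l r<r'

  -- Conversely (i) and (ii) make every arc valid at its stage: its endpoints
  -- have not been deleted, and by (ii) the points between the endpoints of a
  -- marked arc have been.
  conditions⇒valid : ∀ ω → IsPartialMatching ω → (∀ k → Conditions ω k) → AllValid full ω
  conditions⇒valid ω PM conds k =
    condI⇒valid (lookup ω k) (proj₁ (conds k)) (endpoint (inj₁ refl)) (endpoint (inj₂ refl)) gap
    where
    endpoint : ∀ {x} → x ∈ₐ lookup ω k → x ∈ stage full ω k
    endpoint x∈k = endpoint-remains PM full (toℕ k) ∈⊤ x∈k (<-irrefl refl)
    gap : marked (lookup ω k) ≡ true →
          ∀ i' → left (lookup ω k) < i' → i' < right (lookup ω k) → i' ∉ stage full ω k
    gap isMarked i' l<i' i'<r i'∈stage =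
      let (k' , i'∈k' , k'<k) = proj₁ (proj₂ (conds k)) isMarked i' l<i' i'<r in
      proj₂ (∈-remaining full ω (toℕ k) i'∈stage) k' k'<k i'∈k'

  moved⇒on-unmarked-arc : ∀ ω → (∀ k → CondI C (lookup ω k)) → Terminal C (remaining full ω) →
                          ∀ x → γ x ≢ x → ∃[ k ] (x ∈ₐ lookup ω k × marked (lookup ω k) ≡ false)
  moved⇒on-unmarked-arc ω condI (fixed , _) x γx≢x
    with remaining-or-deleted full ω (length ω) (∈⊤ {x = x})
  ... | inj₁ x∈end   = contradiction
        (fixed x (subst (λ ω' → x ∈ remaining full ω') (take-all (length ω) ω ≤-refl) x∈end)) γx≢x
  ... | inj₂ (k , x∈k , _) = k , x∈k , moved-endpoint⇒unmarked (lookup ω k) (condI k) x∈k γx≢x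

  -- (i) and (iii) exclude nesting: a matched pair {i' < j'} of stage k around
  -- arc k is an unmarked arc of ω; by (iii) it comes before arc k, so i' would
  -- already have been deleted.
  conditions⇒notNested : ∀ ω → IsPartialMatching ω → (∀ k → Conditions ω k) →
                         Terminal C (remaining full ω) → AllNotNested full ω
  conditions⇒notNested ω PM conds T k i' j' i'∈stage _ γi'≡j' i'<l r<j' =
    let (k' , i'∈k' , unmarked) = moved⇒on-unmarked-arc ω (proj₁ ∘ conds) T i' γi'≢i' in
    enclosing k' i'∈k' unmarked
    where
    i'<j' : i' < j'
    i'<j' = Fin.<-trans i'<l (Fin.<-trans (lt (lookup ω k)) r<j')
    γi'≢i' : γ i' ≢ i'
    γi'≢i' γi'≡i' = Fin.<⇒≢ i'<j' (trans (sym γi'≡i') γi'≡j')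
    enclosing : ∀ k' → i' ∈ₐ lookup ω k' → marked (lookup ω k') ≡ false → ⊥
    enclosing k' (inj₁ i'≡l') unmarked =
      contradiction i'∈k' (proj₂ (∈-remaining full ω (toℕ k) i'∈stage) k' k'<k)
      where
      i'∈k' : i' ∈ₐ lookup ω k'
      i'∈k' = inj₁ i'≡l'
      j'≡r' : j' ≡ right (lookup ω k')
      j'≡r' = trans (sym γi'≡j') (trans (cong γ i'≡l') (proj₁ (proj₁ (conds k')) unmarked))
      k'<k : k' < k
      k'<k = proj₂ (proj₂ (conds k)) k' unmarked (subst (_< left (lookup ω k)) i'≡l' i'<l)
                                                  (subst (right (lookup ω k) <_) j'≡r' r<j')
    enclosing k' (inj₂ i'≡r') unmarked = contradiction j'<i' (Fin.<-asym i'<j')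
      where
      j'≡l' : j' ≡ left (lookup ω k')
      j'≡l' = trans (sym γi'≡j') (trans (cong γ i'≡r') (swap (proj₁ (proj₁ (conds k')) unmarked)))
      j'<i' : j' < i'
      j'<i' = subst₂ _<_ (sym j'≡l') (sym i'≡r') (lt (lookup ω k'))

  shape⇒conditions : ∀ ω → IsPartialMatching ω → IsLabelledShape C ω →
                     length ω ≡ p ⊓ q × (∀ k → Conditions ω k)
  shape⇒conditions ω PM run =
    let (valids , notNesteds , T) = run⇒stages run in
    Equivalence.to (terminal⇔length ω valids) T ,
    λ k → valid⇒condI (valids k) , valid⇒condII ω k (valids k) ,
          notNested⇒condIII ω PM valids k (notNesteds k)

  conditions⇒shape : ∀ ω → IsPartialMatching ω →
                     length ω ≡ p ⊓ q × (∀ k → Conditions ω k) → IsLabelledShape C ω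
  conditions⇒shape ω PM (len , conds) =
    stages⇒run full ω valids (conditions⇒notNested ω PM conds T) T
    where
    valids : AllValid full ω
    valids = conditions⇒valid ω PM conds
    T : Terminal C (remaining full ω)
    T = Equivalence.from (terminal⇔length ω valids) len

mainTheorem10 : ∀ {p q : ℕ} (C : Clan p q) (ω : List (Arc (p + q))) →
    IsPartialMatching ω →
    (IsLabelledShape C ω ⇔
      (length ω ≡ p ⊓ q ×
       (∀ (k : Fin (length ω)) →
          CondI C (lookup ω k) × CondII C ω k × CondIII C ω k)))
mainTheorem10 C ω PM = mk⇔ (shape⇒conditions C ω PM) (conditions⇒shape C ω PM)
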